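{- Let $S\subseteq\{0,1\}^n$ be a cube-ideal set-system with connectivity at least $2$. Then $\mathrm{core}(S)$ is also cube-ideal.
   Context: A set-system is a subset $S\subseteq\{0,1\}^n$ with convex hull $\mathrm{conv}(S)$. A GSC inequality is $\sum_{i\in I}x_i+\sum_{j\in J}(1-x_j)\geq1$ for disjoint $I,J\subseteq[n]$, using $|I|+|J|$ variables; a $2$-GSC inequality uses exactly $2$ variables; capacity inequalities are $x_i\geq0$, $x_i\leq1$. $S$ is cube-ideal if $\mathrm{conv}(S)$ is the solution set of a finite family of capacity and GSC inequalities. The connectivity of $S$ is the minimum number of variables in a GSC inequality valid for $\mathrm{conv}(S)$ ($+\infty$ if $S=\{0,1\}^n$). $\mathrm{core}(S)$ is the set of points of $S$ that satisfy every $2$-GSC inequality valid for $\mathrm{conv}(S)$ with equality.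
   Formalization: The convex hull $\mathrm{conv}(S)$ and the solution sets of capacity and GSC inequalities are taken only over points with rational coordinates, with rational convex coefficients. -}

module Defs where

open import Data.Bool using (Bool; true; false; if_then_else_)
open import Data.Nat using (ℕ; zero; suc)
open import Data.Fin using (Fin)
open import Data.Fin.Subset using (Subset; _∈_; ∣_∣)
open import Data.Vec using (lookup)
open import Data.List using (List; []; _∷_)
open import Data.List.Relation.Unary.All using (All)
open import Data.Product using (Σ; _×_; _,_; proj₁; proj₂)
open import Data.Rational using (ℚ; 0ℚ; 1ℚ; _+_; _-_; _*_; _≤_)
open import Relation.Nullary using (¬_)
open import Relation.Binary.PropositionalEquality using (_≡_)
open import Level using (0ℓ)
open import Relation.Unary using (Pred)

Point : ℕ → Set
Point n = Fin n → Bool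

RPoint : ℕ → Set
RPoint n = Fin n → ℚ

SetSystem : ℕ → Set₁
SetSystem n = Pred (Point n) 0ℓ

b2q : Bool → ℚ
b2q true  = 1ℚ
b2q false = 0ℚ

embed : ∀ {n} → Point n → RPoint n
embed s i = b2q (s i)

sumFin : ∀ {n} → (Fin n → ℚ) → ℚ
sumFin {zero}  f = 0ℚ
sumFin {suc n} f = f Fin.zero + sumFin (λ i → f (Fin.suc i))

sumList : ∀ {n} → List (ℚ × Point n) → (ℚ × Point n → ℚ) → ℚ
sumList []       g = 0ℚ
sumList (c ∷ cs) g = g c + sumList cs g

InConv : ∀ {n} → SetSystem n → RPoint n → Set
InConv {n} S x =
  Σ (List (ℚ × Point n)) λ cs →
    All (λ c → (0ℚ ≤ proj₁ c) × S (proj₂ c)) cs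
    × (sumList cs proj₁ ≡ 1ℚ)
    × (∀ i → x i ≡ sumList cs (λ c → proj₁ c * b2q (proj₂ c i)))

Disjoint : ∀ {n} → Subset n → Subset n → Set
Disjoint {n} I J = ∀ (i : Fin n) → ¬ (i ∈ I × i ∈ J)

gscLHS : ∀ {n} → Subset n → Subset n → RPoint n → ℚ
gscLHS I J x =
  sumFin (λ i → if lookup I i then x i else 0ℚ)
  + sumFin (λ i → if lookup J i then 1ℚ - x i else 0ℚ)

nvars : ∀ {n} → Subset n → Subset n → ℕ
nvars I J = ∣ I ∣ Data.Nat.+ ∣ J ∣

data Ineq (n : ℕ) : Set where
  cap0 : Fin n → Ineq n
  cap1 : Fin n → Ineq n
  gsc  : (I J : Subset n) → Disjoint I J → Ineq n

Satisfies : ∀ {n} → Ineq n → RPoint n → Set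
Satisfies (cap0 i)    x = 0ℚ ≤ x i
Satisfies (cap1 i)    x = x i ≤ 1ℚ
Satisfies (gsc I J _) x = 1ℚ ≤ gscLHS I J x

ValidGSC : ∀ {n} → SetSystem n → Subset n → Subset n → Set
ValidGSC S I J = ∀ x → InConv S x → 1ℚ ≤ gscLHS I J x

CubeIdeal : ∀ {n} → SetSystem n → Set
CubeIdeal {n} S =
  Σ (List (Ineq n)) λ F →
    ∀ (x : RPoint n) → (InConv S x → All (λ c → Satisfies c x) F)
                     × (All (λ c → Satisfies c x) F → InConv S x)

-- connectivity of S is at least k: every GSC inequality valid for conv(S)
-- uses at least k variables (vacuous when S = {0,1}^n, connectivity +∞)
ConnectivityAtLeast : ∀ {n} → ℕ → SetSystem n → Set
ConnectivityAtLeast {n} k S =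
  ∀ (I J : Subset n) → Disjoint I J → ValidGSC S I J → k Data.Nat.≤ nvars I J

core : ∀ {n} → SetSystem n → SetSystem n
core {n} S s =
  S s × (∀ (I J : Subset n) → Disjoint I J → nvars I J ≡ 2 → ValidGSC S I J
         → gscLHS I J (embed s) ≡ 1ℚ)

{-# OPTIONS --safe #-}
module Submission where

-- conv(core S) is the face of conv(S) on which every valid 2-GSC inequality is
-- tight: a convex combination of points of S makes a valid GSC inequality tight
-- exactly when every point of positive weight does.  Swapping I and J in a 2-GSC
-- inequality a(x) ≥ 1 gives a GSC inequality a'(x) ≥ 1 with a + a' = 2, so on
-- conv(S) tightness of a is just the inequality a' ≥ 1.  Hence a description of
-- conv(S) together with the reversed valid 2-GSC inequalities describes
-- conv(core S).  These can be found effectively, because validity only needs to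
-- be checked at the 0/1 points satisfying the description of conv(S).

open import Defs
open import Data.Nat using (ℕ; zero; suc)
import Data.Nat as ℕ
open import Data.Bool using (true; false; if_then_else_)
open import Data.Fin using (Fin)
open import Data.Fin.Subset using (Subset; ∣_∣)
open import Data.Fin.Subset.Properties using (anySubset?; _∈?_)
import Data.Fin.Properties as Fin
open import Data.Vec using ([]; _∷_; lookup; tabulate)
open import Data.Vec.Properties using (lookup∘tabulate)
open import Data.List using (List; []; _∷_; [_]; _++_; filter; concatMap; cartesianProduct; cartesianProductWith)
open import Data.List.Relation.Unary.All as All using (All; []; _∷_)
open import Data.List.Relation.Unary.All.Properties using (++⁺; ++⁻ˡ; ++⁻ʳ; concat⁺; concat⁻; map⁺; map⁻)
open import Data.List.Relation.Unary.Any using (here; there)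
open import Data.List.Membership.Propositional using (_∈_)
open import Data.List.Membership.Propositional.Properties
  using (∈-filter⁻; ∈-cartesianProduct⁺; ∈-cartesianProductWith⁺)
open import Data.Product using (_×_; _,_; proj₁; proj₂; swap)
open import Function using (_∘_; _⇔_; mk⇔; Equivalence)
open import Relation.Nullary using (¬_; Dec; yes; no; contradiction)
open import Relation.Nullary.Decidable using (map′; _×-dec_; _→-dec_; ¬?; decidable-stable)
open import Relation.Unary using (Decidable; _⊆_)
open import Relation.Binary.PropositionalEquality using (_≡_; _≢_; refl; sym; trans; cong; cong₂; subst; module ≡-Reasoning)
open import Data.Rational using (ℚ; 0ℚ; 1ℚ; _+_; _-_; _*_; _≤_; nonNegative; ≢-nonZero)
open import Data.Rational.Properties
open import Algebra.Properties.Monoid.Mult +-0-monoid using () renaming (_×_ to _×ℚ_; ×-homo-+ to ×ℚ-homo-+)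
open import Algebra.Properties.Group +-0-group using (∙-cancelˡ)
open import Data.Rational.Solver using (module +-*-Solver)
open +-*-Solver

private
  variable
    n : ℕ

+-tightˡ : ∀ {a b c d : ℚ} → a ≤ b → c ≤ d → a + c ≡ b + d → a ≡ b
+-tightˡ a≤b c≤d eq = ≤-antisym a≤b (≮⇒≥ (λ a<b → <-irrefl eq (+-mono-<-≤ a<b c≤d)))

*-cancelˡ-≡-nonZero : ∀ {w a b : ℚ} → 0ℚ ≤ w → w ≢ 0ℚ → w * a ≡ w * b → a ≡ b
*-cancelˡ-≡-nonZero {w} 0≤w w≢0 eq =
  ≤-antisym (*-cancelˡ-≤-pos w (≤-reflexive eq)) (*-cancelˡ-≤-pos w (≤-reflexive (sym eq)))
  where
  instance
    _ = nonNeg∧nonZero⇒pos w {{nonNegative 0≤w}} {{≢-nonZero w≢0}}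

WeightedPoints : ℕ → Set
WeightedPoints n = List (ℚ × Point n)

totalWeight : WeightedPoints n → ℚ
totalWeight cs = sumList cs proj₁

wsum : WeightedPoints n → (Point n → ℚ) → ℚ
wsum cs f = sumList cs (λ c → proj₁ c * f (proj₂ c))

wsum-+ : ∀ (cs : WeightedPoints n) f g → wsum cs (λ p → f p + g p) ≡ wsum cs f + wsum cs g
wsum-+ [] f g = sym (+-identityʳ 0ℚ)
wsum-+ ((w , p) ∷ cs) f g = trans (cong (w * (f p + g p) +_) (wsum-+ cs f g))
  (solve 5 (λ w a b x y → w :* (a :+ b) :+ (x :+ y) := (w :* a :+ x) :+ (w :* b :+ y))
         refl w (f p) (g p) (wsum cs f) (wsum cs g))

wsum-const : ∀ (cs : WeightedPoints n) a → wsum cs (λ _ → a) ≡ totalWeight cs * a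
wsum-const [] a = sym (*-zeroˡ a)
wsum-const ((w , _) ∷ cs) a = trans (cong (w * a +_) (wsum-const cs a)) (sym (*-distribʳ-+ a w _))

wsum-complement : ∀ (cs : WeightedPoints n) f → wsum cs (λ p → 1ℚ - f p) ≡ totalWeight cs - wsum cs f
wsum-complement [] f = refl
wsum-complement ((w , p) ∷ cs) f = trans (cong (w * (1ℚ - f p) +_) (wsum-complement cs f))
  (solve 4 (λ w v t x → w :* (con 1ℚ :- v) :+ (t :- x) := (w :+ t) :- (w :* v :+ x))
         refl w (f p) (totalWeight cs) (wsum cs f))

wsum-const-convex : ∀ (cs : WeightedPoints n) → totalWeight cs ≡ 1ℚ → ∀ a → wsum cs (λ _ → a) ≡ a
wsum-const-convex cs total≡1 a =
  trans (wsum-const cs a) (trans (cong (_* a) total≡1) (*-identityˡ a))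

sumFin-wsum : ∀ {m} (cs : WeightedPoints n) (f : Fin m → Point n → ℚ) →
              sumFin (λ i → wsum cs (f i)) ≡ wsum cs (λ p → sumFin (λ i → f i p))
sumFin-wsum {m = zero} cs f = sym (trans (wsum-const cs 0ℚ) (*-zeroʳ (totalWeight cs)))
sumFin-wsum {m = suc m} cs f =
  trans (cong (wsum cs (f Fin.zero) +_) (sumFin-wsum cs (f ∘ Fin.suc)))
        (sym (wsum-+ cs (f Fin.zero) _))

wsum-mono-≤ : ∀ {cs : WeightedPoints n} {f g} → All (λ c → 0ℚ ≤ proj₁ c) cs →
              All (λ c → f (proj₂ c) ≤ g (proj₂ c)) cs → wsum cs f ≤ wsum cs g
wsum-mono-≤ [] [] = ≤-refl
wsum-mono-≤ {cs = (w , _) ∷ _} (0≤w ∷ ws) (f≤g ∷ fs≤gs) =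
  +-mono-≤ (*-monoˡ-≤-nonNeg w {{nonNegative 0≤w}} f≤g) (wsum-mono-≤ ws fs≤gs)

wsum-tight : ∀ {cs : WeightedPoints n} {f g} → All (λ c → 0ℚ ≤ proj₁ c) cs →
             All (λ c → f (proj₂ c) ≤ g (proj₂ c)) cs → wsum cs f ≡ wsum cs g →
             All (λ c → proj₁ c ≢ 0ℚ → f (proj₂ c) ≡ g (proj₂ c)) cs
wsum-tight [] [] _ = []
wsum-tight {cs = (w , p) ∷ cs} {f} {g} (0≤w ∷ ws) (f≤g ∷ fs≤gs) eq =
  (λ w≢0 → *-cancelˡ-≡-nonZero 0≤w w≢0 head≡) ∷ wsum-tight ws fs≤gs tail≡
  where
  head≤ : w * f p ≤ w * g p
  head≤ = *-monoˡ-≤-nonNeg w {{nonNegative 0≤w}} f≤g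
  tail≤ : wsum cs f ≤ wsum cs g
  tail≤ = wsum-mono-≤ ws fs≤gs
  head≡ : w * f p ≡ w * g p
  head≡ = +-tightˡ head≤ tail≤ eq
  tail≡ : wsum cs f ≡ wsum cs g
  tail≡ = +-tightˡ tail≤ head≤
    (trans (+-comm (wsum cs f) (w * f p)) (trans eq (+-comm (w * g p) (wsum cs g))))

sumList-filter : ∀ {P : ℚ × Point n → Set} (P? : Decidable P) (cs : WeightedPoints n) g →
                 (∀ c → ¬ P c → g c ≡ 0ℚ) → sumList (filter P? cs) g ≡ sumList cs g
sumList-filter P? [] g null = refl
sumList-filter P? (c ∷ cs) g null with P? c
... | yes _  = cong (g c +_) (sumList-filter P? cs g null)
... | no ¬Pc = trans (sumList-filter P? cs g null)
                     (sym (trans (cong (_+ sumList cs g) (null c ¬Pc)) (+-identityˡ (sumList cs g))))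

posLiterals : Subset n → RPoint n → ℚ
posLiterals I x = sumFin (λ i → if lookup I i then x i else 0ℚ)

negLiterals : Subset n → RPoint n → ℚ
negLiterals J x = sumFin (λ i → if lookup J i then 1ℚ - x i else 0ℚ)

sumFin-cong : ∀ {m} {f g : Fin m → ℚ} → (∀ i → f i ≡ g i) → sumFin f ≡ sumFin g
sumFin-cong {m = zero} _ = refl
sumFin-cong {m = suc m} f≗g = cong₂ _+_ (f≗g Fin.zero) (sumFin-cong (f≗g ∘ Fin.suc))

sumFin-+ : ∀ {m} (f g : Fin m → ℚ) → sumFin (λ i → f i + g i) ≡ sumFin f + sumFin g
sumFin-+ {m = zero} f g = sym (+-identityˡ 0ℚ)
sumFin-+ {m = suc m} f g = trans (cong (f Fin.zero + g Fin.zero +_) (sumFin-+ (f ∘ Fin.suc) (g ∘ Fin.suc)))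
  (solve 4 (λ a b x y → (a :+ b) :+ (x :+ y) := (a :+ x) :+ (b :+ y))
         refl (f Fin.zero) (g Fin.zero) (sumFin (f ∘ Fin.suc)) (sumFin (g ∘ Fin.suc)))

sumFin-indicator : (I : Subset n) → sumFin (λ i → if lookup I i then 1ℚ else 0ℚ) ≡ ∣ I ∣ ×ℚ 1ℚ
sumFin-indicator [] = refl
sumFin-indicator (true ∷ I) = cong (1ℚ +_) (sumFin-indicator I)
sumFin-indicator (false ∷ I) = trans (+-identityˡ _) (sumFin-indicator I)

gscLHS-cong : ∀ (I J : Subset n) {x y} → (∀ i → x i ≡ y i) → gscLHS I J x ≡ gscLHS I J y
gscLHS-cong I J x≗y = cong₂ _+_
  (sumFin-cong (λ i → cong (λ v → if lookup I i then v else 0ℚ) (x≗y i)))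
  (sumFin-cong (λ i → cong (λ v → if lookup J i then 1ℚ - v else 0ℚ) (x≗y i)))

literals-complement : (I : Subset n) (x : RPoint n) → posLiterals I x + negLiterals I x ≡ ∣ I ∣ ×ℚ 1ℚ
literals-complement I x = trans (sym (sumFin-+ (λ i → if lookup I i then x i else 0ℚ)
                                                 (λ i → if lookup I i then 1ℚ - x i else 0ℚ)))
  (trans (sumFin-cong (λ i → pair (lookup I i) (x i))) (sumFin-indicator I))
  where
  pair : ∀ b v → (if b then v else 0ℚ) + (if b then 1ℚ - v else 0ℚ) ≡ (if b then 1ℚ else 0ℚ)
  pair true  v = solve 1 (λ v → v :+ (con 1ℚ :- v) := con 1ℚ) refl v
  pair false v = +-identityˡ 0ℚ

gscLHS-+-reverse : (I J : Subset n) (x : RPoint n) → gscLHS I J x + gscLHS J I x ≡ nvars I J ×ℚ 1ℚ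
gscLHS-+-reverse I J x = begin
  (posLiterals I x + negLiterals J x) + (posLiterals J x + negLiterals I x)
    ≡⟨ solve 4 (λ a b c d → (a :+ b) :+ (c :+ d) := (a :+ d) :+ (c :+ b))
             refl (posLiterals I x) (negLiterals J x) (posLiterals J x) (negLiterals I x) ⟩
  (posLiterals I x + negLiterals I x) + (posLiterals J x + negLiterals J x)
    ≡⟨ cong₂ _+_ (literals-complement I x) (literals-complement J x) ⟩
  ∣ I ∣ ×ℚ 1ℚ + ∣ J ∣ ×ℚ 1ℚ
    ≡⟨ sym (×ℚ-homo-+ 1ℚ ∣ I ∣ ∣ J ∣) ⟩
  nvars I J ×ℚ 1ℚ ∎
  where open ≡-Reasoning

gscLHS-+-reverse-2 : ∀ (I J : Subset n) x → nvars I J ≡ 2 → gscLHS I J x + gscLHS J I x ≡ 1ℚ + 1ℚ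
gscLHS-+-reverse-2 I J x two =
  trans (gscLHS-+-reverse I J x) (trans (cong (_×ℚ 1ℚ) two) (cong (1ℚ +_) (+-identityʳ 1ℚ)))

gscLHS-tight-2 : ∀ (I J : Subset n) {x} → nvars I J ≡ 2 →
                 1ℚ ≤ gscLHS I J x → 1ℚ ≤ gscLHS J I x → gscLHS I J x ≡ 1ℚ
gscLHS-tight-2 I J {x} two 1≤a 1≤b = sym (+-tightˡ 1≤a 1≤b (sym (gscLHS-+-reverse-2 I J x two)))

gscLHS-reverse-tight-2 : ∀ (I J : Subset n) {x} → nvars I J ≡ 2 →
                         gscLHS I J x ≡ 1ℚ → gscLHS J I x ≡ 1ℚ
gscLHS-reverse-tight-2 I J {x} two a≡1 =
  ∙-cancelˡ 1ℚ (gscLHS J I x) 1ℚ (trans (cong (_+ gscLHS J I x) (sym a≡1)) (gscLHS-+-reverse-2 I J x two))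

gscLHS-wsum : ∀ (I J : Subset n) (cs : WeightedPoints n) {x} → totalWeight cs ≡ 1ℚ →
              (∀ i → x i ≡ wsum cs (λ p → b2q (p i))) →
              gscLHS I J x ≡ wsum cs (gscLHS I J ∘ embed)
gscLHS-wsum I J cs {x} total≡1 x≗ = begin
  posLiterals I x + negLiterals J x
    ≡⟨ cong₂ _+_ (sumFin-cong (λ i → pos (lookup I i) i)) (sumFin-cong (λ i → neg (lookup J i) i)) ⟩
  sumFin (λ i → wsum cs (λ p → if lookup I i then b2q (p i) else 0ℚ))
    + sumFin (λ i → wsum cs (λ p → if lookup J i then 1ℚ - b2q (p i) else 0ℚ))
    ≡⟨ cong₂ _+_ (sumFin-wsum cs (λ i p → if lookup I i then b2q (p i) else 0ℚ))
                 (sumFin-wsum cs (λ i p → if lookup J i then 1ℚ - b2q (p i) else 0ℚ)) ⟩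
  wsum cs (posLiterals I ∘ embed) + wsum cs (negLiterals J ∘ embed)
    ≡⟨ sym (wsum-+ cs _ _) ⟩
  wsum cs (gscLHS I J ∘ embed) ∎
  where
  open ≡-Reasoning
  pos : ∀ b i → (if b then x i else 0ℚ) ≡ wsum cs (λ p → if b then b2q (p i) else 0ℚ)
  pos true  i = x≗ i
  pos false i = sym (wsum-const-convex cs total≡1 0ℚ)
  neg : ∀ b i → (if b then 1ℚ - x i else 0ℚ) ≡ wsum cs (λ p → if b then 1ℚ - b2q (p i) else 0ℚ)
  neg true  i = sym (trans (wsum-complement cs _) (cong₂ _-_ total≡1 (sym (x≗ i))))
  neg false i = sym (wsum-const-convex cs total≡1 0ℚ)

InConv-mono : ∀ {S T : SetSystem n} → S ⊆ T → InConv S ⊆ InConv T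
InConv-mono S⊆T (cs , ws , total≡1 , x≗) = cs , All.map (λ (0≤w , Sp) → 0≤w , S⊆T Sp) ws , total≡1 , x≗

InConv-cong : ∀ {S : SetSystem n} {x y} → (∀ i → x i ≡ y i) → InConv S x → InConv S y
InConv-cong x≗y (cs , ws , total≡1 , x≗) = cs , ws , total≡1 , (λ i → trans (sym (x≗y i)) (x≗ i))

embed-InConv : ∀ {S : SetSystem n} {s} → S s → InConv S (embed s)
embed-InConv {s = s} Ss = [ (1ℚ , s) ] , (nonNegative⁻¹ 1ℚ , Ss) ∷ [] , +-identityʳ 1ℚ ,
  (λ i → sym (trans (+-identityʳ _) (*-identityˡ _)))

ValidGSC-fromPoints : ∀ {S : SetSystem n} {I J} →
                      (∀ {s} → S s → 1ℚ ≤ gscLHS I J (embed s)) → ValidGSC S I J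
ValidGSC-fromPoints {I = I} {J} valid x (cs , ws , total≡1 , x≗) = begin
  1ℚ                           ≡⟨ sym (wsum-const-convex cs total≡1 1ℚ) ⟩
  wsum cs (λ _ → 1ℚ)           ≤⟨ wsum-mono-≤ (All.map proj₁ ws) (All.map (valid ∘ proj₂) ws) ⟩
  wsum cs (gscLHS I J ∘ embed) ≡⟨ sym (gscLHS-wsum I J cs total≡1 x≗) ⟩
  gscLHS I J x                 ∎
  where open ≤-Reasoning

TightOn : (Subset n → Subset n → Set) → SetSystem n
TightOn P s = ∀ {I J} → P I J → gscLHS I J (embed s) ≡ 1ℚ

-- Zero weights are discarded first: those points need not lie on the face.
InConv-face : ∀ {S : SetSystem n} {P : Subset n → Subset n → Set} {x} →
              (∀ {I J} → P I J → ValidGSC S I J) → InConv S x → (∀ {I J} → P I J → gscLHS I J x ≡ 1ℚ) →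
              InConv (λ s → S s × TightOn P s) x
InConv-face {S = S} {P} {x} valid (cs , ws , total≡1 , x≗) x-tight =
  support , All.tabulate onFace , total⁺≡1 , x≗⁺
  where
  nonNull? : Decidable (λ (c : ℚ × Point _) → proj₁ c ≢ 0ℚ)
  nonNull? c = ¬? (proj₁ c ≟ 0ℚ)

  null : ∀ c → ¬ (proj₁ c ≢ 0ℚ) → proj₁ c ≡ 0ℚ
  null c = decidable-stable (proj₁ c ≟ 0ℚ)

  support = filter nonNull? cs

  total⁺≡1 : totalWeight support ≡ 1ℚ
  total⁺≡1 = trans (sumList-filter nonNull? cs proj₁ null) total≡1

  x≗⁺ : ∀ i → x i ≡ wsum support (λ p → b2q (p i))
  x≗⁺ i = trans (x≗ i) (sym (sumList-filter nonNull? cs _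
    (λ (w , p) w≡0 → trans (cong (_* b2q (p i)) (null (w , p) w≡0)) (*-zeroˡ (b2q (p i))))))

  tight : ∀ {I J} → P I J → All (λ c → proj₁ c ≢ 0ℚ → 1ℚ ≡ gscLHS I J (embed (proj₂ c))) cs
  tight {I} {J} PIJ = wsum-tight (All.map proj₁ ws)
    (All.map (λ (_ , Sp) → valid PIJ _ (embed-InConv Sp)) ws)
    (trans (wsum-const-convex cs total≡1 1ℚ) (trans (sym (x-tight PIJ)) (gscLHS-wsum I J cs total≡1 x≗)))

  onFace : ∀ {c} → c ∈ support → (0ℚ ≤ proj₁ c) × (S (proj₂ c) × TightOn P (proj₂ c))
  onFace c∈ with ∈-filter⁻ nonNull? c∈
  ... | c∈cs , w≢0 = proj₁ (All.lookup ws c∈cs) , proj₂ (All.lookup ws c∈cs) ,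
                     (λ PIJ → sym (All.lookup (tight PIJ) c∈cs w≢0))

Satisfies? : (c : Ineq n) (x : RPoint n) → Dec (Satisfies c x)
Satisfies? (cap0 i) x = 0ℚ ≤? x i
Satisfies? (cap1 i) x = x i ≤? 1ℚ
Satisfies? (gsc I J _) x = 1ℚ ≤? gscLHS I J x

allPoints? : ∀ {Q : Point n → Set} → (∀ {p q} → (∀ i → p i ≡ q i) → Q p → Q q) →
             Decidable Q → Dec (∀ p → Q p)
allPoints? resp Q? with anySubset? (λ v → ¬? (Q? (lookup v)))
... | yes (v , ¬Qv) = no (λ ∀Q → ¬Qv (∀Q (lookup v)))
... | no ¬∃ = yes (λ p → resp (lookup∘tabulate p)
                              (decidable-stable (Q? _) (λ ¬Qp → ¬∃ (tabulate p , ¬Qp))))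

Disjoint? : (I J : Subset n) → Dec (Disjoint I J)
Disjoint? I J = Fin.all? (λ i → ¬? ((i ∈? I) ×-dec (i ∈? J)))

subsets : ∀ n → List (Subset n)
subsets zero    = [ [] ]
subsets (suc n) = cartesianProductWith _∷_ (true ∷ false ∷ []) (subsets n)

∈-subsets : (I : Subset n) → I ∈ subsets n
∈-subsets [] = here refl
∈-subsets (b ∷ I) = ∈-cartesianProductWith⁺ _∷_ (∈-bools b) (∈-subsets I)
  where
  ∈-bools : ∀ b → b ∈ true ∷ false ∷ []
  ∈-bools true  = here refl
  ∈-bools false = there (here refl)

subsetPairs : List (Subset n × Subset n)
subsetPairs {n} = cartesianProduct (subsets n) (subsets n)

TwoGSC : SetSystem n → Subset n → Subset n → Set
TwoGSC S I J = Disjoint I J × nvars I J ≡ 2 × ValidGSC S I J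

module _ {S : SetSystem n} (cubeIdeal : CubeIdeal S) where

  private
    F = proj₁ cubeIdeal

  InConv⇔satisfies : ∀ x → InConv S x ⇔ All (λ c → Satisfies c x) F
  InConv⇔satisfies x = mk⇔ (proj₁ (proj₂ cubeIdeal x)) (proj₂ (proj₂ cubeIdeal x))

  InConv? : Decidable (InConv S)
  InConv? x = map′ (Equivalence.from (InConv⇔satisfies x)) (Equivalence.to (InConv⇔satisfies x))
                   (All.all? (λ c → Satisfies? c x) F)

  ValidGSC? : (I J : Subset n) → Dec (ValidGSC S I J)
  ValidGSC? I J =
    map′ (λ valid → ValidGSC-fromPoints {I = I} {J = J} (λ {s} Ss → valid s (embed-InConv Ss)))
         (λ valid p → valid (embed p))
         (allPoints? {Q = ValidAt} resp (λ p → InConv? (embed p) →-dec (1ℚ ≤? gscLHS I J (embed p))))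
    where
    ValidAt : Point n → Set
    ValidAt p = InConv S (embed p) → 1ℚ ≤ gscLHS I J (embed p)
    resp : ∀ {p q} → (∀ i → p i ≡ q i) → ValidAt p → ValidAt q
    resp p≗q valid q∈ = subst (1ℚ ≤_) (gscLHS-cong I J (cong b2q ∘ p≗q))
                              (valid (InConv-cong (cong b2q ∘ sym ∘ p≗q) q∈))

  TwoGSC? : (I J : Subset n) → Dec (TwoGSC S I J)
  TwoGSC? I J = Disjoint? I J ×-dec (nvars I J ℕ.≟ 2) ×-dec ValidGSC? I J

  reversedIf : ∀ {I J} → Dec (TwoGSC S I J) → List (Ineq n)
  reversedIf {I} {J} (yes (disjoint , _)) = [ gsc J I (λ i → disjoint i ∘ swap) ]
  reversedIf (no _) = []

  reversedIfTwoGSC : Subset n × Subset n → List (Ineq n)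
  reversedIfTwoGSC (I , J) = reversedIf (TwoGSC? I J)

  reversedTwoGSCs : List (Ineq n)
  reversedTwoGSCs = concatMap reversedIfTwoGSC subsetPairs

  satisfies-reversedTwoGSCs : ∀ x → All (λ c → Satisfies c x) reversedTwoGSCs ⇔
                                    (∀ {I J} → TwoGSC S I J → 1ℚ ≤ gscLHS J I x)
  satisfies-reversedTwoGSCs x = mk⇔ to from
    where
    reversedIf⁻ : ∀ {I J} (d : Dec (TwoGSC S I J)) → TwoGSC S I J →
                  All (λ c → Satisfies c x) (reversedIf d) → 1ℚ ≤ gscLHS J I x
    reversedIf⁻ (yes _) _ (sat ∷ []) = sat
    reversedIf⁻ (no ¬t) t _ = contradiction t ¬t

    reversedIf⁺ : ∀ {I J} (d : Dec (TwoGSC S I J)) → (TwoGSC S I J → 1ℚ ≤ gscLHS J I x) →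
                  All (λ c → Satisfies c x) (reversedIf d)
    reversedIf⁺ (yes t) sat = sat t ∷ []
    reversedIf⁺ (no _) _ = []

    to : All (λ c → Satisfies c x) reversedTwoGSCs → ∀ {I J} → TwoGSC S I J → 1ℚ ≤ gscLHS J I x
    to sat {I} {J} t = reversedIf⁻ (TwoGSC? I J) t
      (All.lookup (map⁻ {f = reversedIfTwoGSC} (concat⁻ sat)) (∈-cartesianProduct⁺ (∈-subsets I) (∈-subsets J)))

    from : (∀ {I J} → TwoGSC S I J → 1ℚ ≤ gscLHS J I x) → All (λ c → Satisfies c x) reversedTwoGSCs
    from sat = concat⁺ (map⁺ {f = reversedIfTwoGSC}
      (All.universal (λ (I , J) → reversedIf⁺ (TwoGSC? I J) (sat {I} {J})) subsetPairs))

  InConv-core⇒satisfies : ∀ {x} → InConv (core S) x → All (λ c → Satisfies c x) (F ++ reversedTwoGSCs)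
  InConv-core⇒satisfies {x} x∈ =
    ++⁺ (Equivalence.to (InConv⇔satisfies x) (InConv-mono proj₁ x∈))
        (Equivalence.from (satisfies-reversedTwoGSCs x)
          (λ {I} {J} (disjoint , two , valid) → ValidGSC-fromPoints {I = J} {J = I}
            (λ (_ , tight) → ≤-reflexive (sym (gscLHS-reverse-tight-2 I J two (tight I J disjoint two valid))))
            x x∈))

  satisfies⇒InConv-core : ∀ {x} → All (λ c → Satisfies c x) (F ++ reversedTwoGSCs) → InConv (core S) x
  satisfies⇒InConv-core {x} sat =
    InConv-mono (λ (Ss , tight) → Ss , λ I J disjoint two valid → tight {I} {J} (disjoint , two , valid))
      (InConv-face {P = TwoGSC S} (proj₂ ∘ proj₂) x∈S
        (λ {I} {J} t@(_ , two , valid) → gscLHS-tight-2 I J two (valid x x∈S) (reversed t)))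
    where
    x∈S : InConv S x
    x∈S = Equivalence.from (InConv⇔satisfies x) (++⁻ˡ F sat)
    reversed : ∀ {I J} → TwoGSC S I J → 1ℚ ≤ gscLHS J I x
    reversed = Equivalence.to (satisfies-reversedTwoGSCs x) (++⁻ʳ F sat)

theorem4p3 : ∀ (n : ℕ) (S : SetSystem n) → CubeIdeal S → ConnectivityAtLeast 2 S → CubeIdeal (core S)
theorem4p3 n S cubeIdeal _ =
  proj₁ cubeIdeal ++ reversedTwoGSCs cubeIdeal ,
  λ x → InConv-core⇒satisfies cubeIdeal , satisfies⇒InConv-core cubeIdeal
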